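{- For each cycle $C_n$ with $n\ge3$ vertices, $v(C_n)=n$.
   Context: $v(G)$ is the minimum number of points of a linear hypergraph (finite point set, lines are subsets of size $\ge2$, two distinct points in at most one line) whose intersection graph (vertices = lines, adjacent iff distinct and intersecting) is isomorphic to $G$. -}

module Defs where

open import Level using (0ℓ)
open import Data.Nat using (ℕ; suc; _+_; _≤_; _%_; NonZero)
open import Data.Fin using (Fin; toℕ)
open import Data.Fin.Subset using (Subset; _∈_; _∩_; ∣_∣)
open import Data.Product using (Σ; ∃; _×_; _,_)
open import Data.Sum using (_⊎_)
open import Function.Bundles using (_↔_; Inverse)
open import Relation.Binary.PropositionalEquality using (_≡_; _≢_)
open import Relation.Nullary using (¬_)

record Graph : Set₁ where
  field
    size : ℕ
    Adj  : Fin size → Fin size → Set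

open Graph public

-- The cycle C_n on vertices 0..n-1, i ~ j iff j ≡ i+1 (mod n) or i ≡ j+1 (mod n).
-- (Intended for n ≥ 3, where this is the usual simple cycle.)
cycle : (n : ℕ) → .{{_ : NonZero n}} → Graph
cycle n = record
  { size = n
  ; Adj  = λ i j → (toℕ j ≡ (toℕ i + 1) % n) ⊎ (toℕ i ≡ (toℕ j + 1) % n)
  }

-- Lines have ≥ 2 points and two distinct lines share at most one point
-- (equivalently: two distinct points lie in at most one line; this also forces
-- the lines to be pairwise distinct as sets).
record LinearHypergraph (p : ℕ) : Set where
  field
    numLines : ℕ
    line     : Fin numLines → Subset p
    lineSize : ∀ i → 2 ≤ ∣ line i ∣
    linear   : ∀ i j → i ≢ j → ∣ line i ∩ line j ∣ ≤ 1

open LinearHypergraph public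

IntAdj : ∀ {p} (H : LinearHypergraph p) → Fin (numLines H) → Fin (numLines H) → Set
IntAdj H i j = i ≢ j × ∃ λ x → x ∈ line H i × x ∈ line H j

record Iso (G : Graph) (m : ℕ) (A : Fin m → Fin m → Set) : Set where
  field
    bij      : Fin (size G) ↔ Fin m
    preserve : ∀ u v → Adj G u v → A (Inverse.to bij u) (Inverse.to bij v)
    reflect  : ∀ u v → A (Inverse.to bij u) (Inverse.to bij v) → Adj G u v

RepresentableWith : Graph → ℕ → Set
RepresentableWith G p =
  Σ (LinearHypergraph p) λ H → Iso G (numLines H) (IntAdj H)

IsV : Graph → ℕ → Set
IsV G k = RepresentableWith G k × (∀ p → RepresentableWith G p → k ≤ p)

{-# OPTIONS --safe #-}
module Submission where

-- The n edges {i, i+1} of C_n, taken as lines on the n vertices, form a linear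
-- hypergraph whose intersection graph is C_n again; so v(C_n) ≤ n.
-- Conversely, choose for every i a point common to the lines of i and i+1.  For
-- n ≥ 4 the cycle is triangle-free, so no point lies on three lines, and these n
-- points are pairwise distinct.  For n = 3 it suffices that two lines of size ≥ 2
-- meeting in at most one point need three points.

open import Defs
open import Data.Nat using (ℕ; zero; suc; _+_; _*_; _/_; _%_; _≤_; _<_; NonZero; z≤n)
open import Data.Nat.Properties
  using (+-assoc; +-identityʳ; 1+n≰n; +-cancelˡ-≡; <⇒≱; ≤-trans; ≤-antisym; m≤n⇒m<n∨m≡n)
open import Data.Nat.DivMod
  using (m≡m%n+[m/n]*n; m%n<n; %-distribˡ-+; m%n%n≡m%n; m<n⇒m%n≡m; [m+n]%n≡m%n)
open import Data.Nat.Divisibility using (_∣_; divides; ∣⇒≤)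
open import Data.Fin as Fin using (Fin; toℕ; fromℕ<; _≟_)
open import Data.Fin.Properties using (toℕ-injective; toℕ-fromℕ<; toℕ<n; injective⇒≤)
open import Data.Fin.Subset using (Subset; _∈_; _∩_; _∪_; _⊆_; ∣_∣; ⁅_⁆; ⊤)
open import Data.Fin.Subset.Properties
  using ( x∈⁅x⁆; x∈⁅y⁆⇒x≡y; x≢y⇒x∉⁅y⁆; ∣⁅x⁆∣≡1; ∣⊥∣≡0; ∣p∣≤n; ∣p∣≡n⇒p≡⊤
        ; p⊆q⇒∣p∣≤∣q∣; p⊂q⇒∣p∣<∣q∣; nonempty?; Empty-unique
        ; x∈p∪q⁻; x∈p∪q⁺; x∈p∩q⁻)
open import Data.Product using (_×_; _,_; proj₁; proj₂; uncurry)
open import Data.Sum using (_⊎_; inj₁; inj₂) renaming (map to map⊎)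
open import Data.Empty using (⊥; ⊥-elim)
open import Function using (_∘_)
open import Function.Bundles using (Inverse; Injection; _⇔_; mk⇔; Equivalence)
open import Function.Definitions using (Injective)
open import Function.Construct.Identity using (↔-id)
open import Function.Properties.Inverse using (↔⇒↣)
open import Relation.Binary.PropositionalEquality
  using (_≡_; _≢_; refl; sym; trans; cong; subst; subst₂; module ≡-Reasoning)
open import Relation.Nullary using (¬_; yes; no; contradiction)

open ≡-Reasoning

[m%n+k]%n≡[m+k]%n : ∀ m k n .{{_ : NonZero n}} → (m % n + k) % n ≡ (m + k) % n
[m%n+k]%n≡[m+k]%n m k n = begin
  (m % n + k) % n           ≡⟨ %-distribˡ-+ (m % n) k n ⟩
  (m % n % n + k % n) % n   ≡⟨ cong (λ r → (r + k % n) % n) (m%n%n≡m%n m n) ⟩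
  (m % n + k % n) % n       ≡⟨ %-distribˡ-+ m k n ⟨
  (m + k) % n               ∎

[m+k]%n≡m⇒n∣k : ∀ m k n .{{_ : NonZero n}} → (m + k) % n ≡ m → n ∣ k
[m+k]%n≡m⇒n∣k m k n eq = divides ((m + k) / n) (+-cancelˡ-≡ m k _ (begin
  m + k                          ≡⟨ m≡m%n+[m/n]*n (m + k) n ⟩
  (m + k) % n + (m + k) / n * n  ≡⟨ cong (_+ (m + k) / n * n) eq ⟩
  m + (m + k) / n * n            ∎))

module _ {n : ℕ} .{{_ : NonZero n}} where

  rotate : Fin n → Fin n
  rotate i = fromℕ< (m%n<n (toℕ i + 1) n)

  toℕ-rotate : ∀ i → toℕ (rotate i) ≡ (toℕ i + 1) % n
  toℕ-rotate i = toℕ-fromℕ< (m%n<n (toℕ i + 1) n)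

  rotate^ : ℕ → Fin n → Fin n
  rotate^ zero    i = i
  rotate^ (suc k) i = rotate^ k (rotate i)

  toℕ-rotate^ : ∀ k i → toℕ (rotate^ k i) ≡ (toℕ i + k) % n
  toℕ-rotate^ zero i = begin
    toℕ i            ≡⟨ m<n⇒m%n≡m (toℕ<n i) ⟨
    toℕ i % n        ≡⟨ cong (_% n) (+-identityʳ (toℕ i)) ⟨
    (toℕ i + 0) % n  ∎
  toℕ-rotate^ (suc k) i = begin
    toℕ (rotate^ k (rotate i))  ≡⟨ toℕ-rotate^ k (rotate i) ⟩
    (toℕ (rotate i) + k) % n    ≡⟨ cong (λ r → (r + k) % n) (toℕ-rotate i) ⟩
    ((toℕ i + 1) % n + k) % n   ≡⟨ [m%n+k]%n≡[m+k]%n (toℕ i + 1) k n ⟩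
    (toℕ i + 1 + k) % n         ≡⟨ cong (_% n) (+-assoc (toℕ i) 1 k) ⟩
    (toℕ i + suc k) % n         ∎

  rotate^n≡id : ∀ i → rotate^ n i ≡ i
  rotate^n≡id i = toℕ-injective (begin
    toℕ (rotate^ n i)  ≡⟨ toℕ-rotate^ n i ⟩
    (toℕ i + n) % n    ≡⟨ [m+n]%n≡m%n (toℕ i) n ⟩
    toℕ i % n          ≡⟨ m<n⇒m%n≡m (toℕ<n i) ⟩
    toℕ i              ∎)

  rotate^-fixfree : ∀ {k} → suc k < n → ∀ i → rotate^ (suc k) i ≢ i
  rotate^-fixfree {k} 1+k<n i eq = <⇒≱ 1+k<n (∣⇒≤ n∣1+k)
    where
    n∣1+k : n ∣ suc k
    n∣1+k = [m+k]%n≡m⇒n∣k (toℕ i) (suc k) n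
              (trans (sym (toℕ-rotate^ (suc k) i)) (cong toℕ eq))

-- rotate^ (suc m) unfolds to rotate^ m ∘ rotate, so by rotate^n≡id, rotate^ m is a
-- left inverse of rotate when n = suc m.
rotate-injective : ∀ {n} .{{_ : NonZero n}} → Injective _≡_ _≡_ (rotate {n})
rotate-injective {suc m} {i} {j} eq = begin
  i                     ≡⟨ rotate^n≡id i ⟨
  rotate^ m (rotate i)  ≡⟨ cong (rotate^ m) eq ⟩
  rotate^ m (rotate j)  ≡⟨ rotate^n≡id j ⟩
  j                     ∎

distinct-members⇒2≤∣p∣ : ∀ {m} {p : Subset m} {x y} → x ∈ p → y ∈ p → x ≢ y → 2 ≤ ∣ p ∣
distinct-members⇒2≤∣p∣ {p = p} {x} x∈p y∈p x≢y =
  subst (_< ∣ p ∣) (∣⁅x⁆∣≡1 x) (p⊂q⇒∣p∣<∣q∣ (⁅x⁆⊆p , _ , y∈p , x≢y⇒x∉⁅y⁆ (x≢y ∘ sym)))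
  where
  ⁅x⁆⊆p : ⁅ x ⁆ ⊆ p
  ⁅x⁆⊆p z∈⁅x⁆ = subst (_∈ p) (sym (x∈⁅y⁆⇒x≡y x z∈⁅x⁆)) x∈p

subsingleton⇒∣p∣≤1 : ∀ {m} {p : Subset m} → (∀ {x y} → x ∈ p → y ∈ p → x ≡ y) → ∣ p ∣ ≤ 1
subsingleton⇒∣p∣≤1 {m} {p} unique with nonempty? p
... | yes (x , x∈p) = subst (∣ p ∣ ≤_) (∣⁅x⁆∣≡1 x) (p⊆q⇒∣p∣≤∣q∣ p⊆⁅x⁆)
  where
  p⊆⁅x⁆ : p ⊆ ⁅ x ⁆
  p⊆⁅x⁆ y∈p = subst (_∈ ⁅ x ⁆) (unique x∈p y∈p) (x∈⁅x⁆ x)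
... | no p-empty =
  subst (λ q → ∣ q ∣ ≤ 1) (sym (Empty-unique p-empty)) (subst (_≤ 1) (sym (∣⊥∣≡0 m)) z≤n)

points≥3 : ∀ {p} (H : LinearHypergraph p) {i j} → i ≢ j → 3 ≤ p
points≥3 {p} H {i} {j} i≢j with m≤n⇒m<n∨m≡n (≤-trans (lineSize H i) (∣p∣≤n (line H i)))
... | inj₁ 2<p  = 2<p
... | inj₂ refl = contradiction (linear H i j i≢j)
                    (subst₂ (λ L M → ¬ ∣ L ∩ M ∣ ≤ 1) (sym (full i)) (sym (full j)) 1+n≰n)
  where
  full : ∀ k → line H k ≡ ⊤
  full k = ∣p∣≡n⇒p≡⊤ (≤-antisym (∣p∣≤n (line H k)) (lineSize H k))

SuccAdj : ∀ {n} → (Fin n → Fin n) → Fin n → Fin n → Set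
SuccAdj s i j = j ≡ s i ⊎ i ≡ s j

TriangleFree : ∀ {n} → (Fin n → Fin n → Set) → Set
TriangleFree _~_ = ∀ {a b c} → a ≢ b → b ≢ c → a ≢ c → a ~ b → b ~ c → a ~ c → ⊥

fixfree²⇒fixfree : ∀ {n} {s : Fin n → Fin n} → (∀ i → s (s i) ≢ i) → ∀ i → s i ≢ i
fixfree²⇒fixfree {s = s} s²-fixfree i eq = s²-fixfree i (trans (cong s eq) eq)

SuccAdj-triangleFree : ∀ {n} {s : Fin n → Fin n} → Injective _≡_ _≡_ s →
                       (∀ i → s (s (s i)) ≢ i) → TriangleFree (SuccAdj s)
SuccAdj-triangleFree s-injective s³-fixfree a≢b b≢c a≢c = λ where
  (inj₁ b≡sa) (inj₁ c≡sb) (inj₁ c≡sa) → a≢b (s-injective (trans (sym c≡sa) c≡sb))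
  (inj₁ refl) (inj₁ refl) (inj₂ a≡sc) → s³-fixfree _ (sym a≡sc)
  (inj₁ b≡sa) (inj₂ b≡sc) _           → a≢c (s-injective (trans (sym b≡sa) b≡sc))
  (inj₂ a≡sb) (inj₁ c≡sb) _           → a≢c (trans a≡sb (sym c≡sb))
  (inj₂ refl) (inj₂ refl) (inj₁ c≡sa) → s³-fixfree _ (sym c≡sa)
  (inj₂ a≡sb) (inj₂ b≡sc) (inj₂ a≡sc) → b≢c (s-injective (trans (sym a≡sb) a≡sc))

module SuccessorEdges {n} (s : Fin n → Fin n) (s-injective : Injective _≡_ _≡_ s)
                      (s²-fixfree : ∀ i → s (s i) ≢ i) where

  s-fixfree : ∀ i → s i ≢ i
  s-fixfree = fixfree²⇒fixfree s²-fixfree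

  edge : Fin n → Subset n
  edge i = ⁅ i ⁆ ∪ ⁅ s i ⁆

  ∈-edge⁻ : ∀ {x} i → x ∈ edge i → x ≡ i ⊎ x ≡ s i
  ∈-edge⁻ i x∈ = map⊎ (x∈⁅y⁆⇒x≡y i) (x∈⁅y⁆⇒x≡y (s i)) (x∈p∪q⁻ ⁅ i ⁆ ⁅ s i ⁆ x∈)

  source∈edge : ∀ i → i ∈ edge i
  source∈edge i = x∈p∪q⁺ (inj₁ (x∈⁅x⁆ i))

  target∈edge : ∀ i → s i ∈ edge i
  target∈edge i = x∈p∪q⁺ (inj₂ (x∈⁅x⁆ (s i)))

  common-point : ∀ {i j x} → i ≢ j → x ∈ edge i → x ∈ edge j →
                 (j ≡ s i × x ≡ j) ⊎ (i ≡ s j × x ≡ i)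
  common-point {i} {j} i≢j x∈i x∈j with ∈-edge⁻ i x∈i | ∈-edge⁻ j x∈j
  ... | inj₁ x≡i  | inj₁ x≡j  = ⊥-elim (i≢j (trans (sym x≡i) x≡j))
  ... | inj₁ x≡i  | inj₂ x≡sj = inj₂ (trans (sym x≡i) x≡sj , x≡i)
  ... | inj₂ x≡si | inj₁ x≡j  = inj₁ (trans (sym x≡j) x≡si , x≡j)
  ... | inj₂ x≡si | inj₂ x≡sj = ⊥-elim (i≢j (s-injective (trans (sym x≡si) x≡sj)))

  common-point-unique : ∀ {i j x y} → i ≢ j → x ∈ edge i ∩ edge j → y ∈ edge i ∩ edge j → x ≡ y
  common-point-unique {i} {j} i≢j x∈ y∈
    with uncurry (common-point i≢j) (x∈p∩q⁻ _ _ x∈) | uncurry (common-point i≢j) (x∈p∩q⁻ _ _ y∈)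
  ... | inj₁ (_ , x≡j)    | inj₁ (_ , y≡j)    = trans x≡j (sym y≡j)
  ... | inj₂ (_ , x≡i)    | inj₂ (_ , y≡i)    = trans x≡i (sym y≡i)
  ... | inj₁ (refl , _)   | inj₂ (i≡ssi , _)  = ⊥-elim (s²-fixfree i (sym i≡ssi))
  ... | inj₂ (refl , _)   | inj₁ (j≡ssj , _)  = ⊥-elim (s²-fixfree j (sym j≡ssj))

  edgeHypergraph : LinearHypergraph n
  edgeHypergraph = record
    { numLines = n
    ; line     = edge
    ; lineSize = λ i → distinct-members⇒2≤∣p∣ (source∈edge i) (target∈edge i)
                         (s-fixfree i ∘ sym)
    ; linear   = λ i j i≢j → subsingleton⇒∣p∣≤1 (common-point-unique i≢j)
    }

  IntAdj⇔SuccAdj : ∀ {i j} → IntAdj edgeHypergraph i j ⇔ SuccAdj s i j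
  IntAdj⇔SuccAdj = mk⇔ intAdj⇒succAdj succAdj⇒intAdj
    where
    intAdj⇒succAdj : ∀ {i j} → IntAdj edgeHypergraph i j → SuccAdj s i j
    intAdj⇒succAdj (i≢j , _ , x∈i , x∈j) = map⊎ proj₁ proj₁ (common-point i≢j x∈i x∈j)
    succAdj⇒intAdj : ∀ {i j} → SuccAdj s i j → IntAdj edgeHypergraph i j
    succAdj⇒intAdj {i} (inj₁ refl) =
      s-fixfree i ∘ sym , s i , target∈edge i , source∈edge (s i)
    succAdj⇒intAdj {j = j} (inj₂ refl) =
      s-fixfree j , s j , source∈edge (s j) , target∈edge j

successorGraph-representable : ∀ {G : Graph} {s : Fin (size G) → Fin (size G)} →
  Injective _≡_ _≡_ s → (∀ i → s (s i) ≢ i) → (∀ {i j} → Adj G i j ⇔ SuccAdj s i j) →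
  RepresentableWith G (size G)
successorGraph-representable {G} {s} s-injective s²-fixfree Adj⇔SuccAdj =
  edgeHypergraph , record
    { bij      = ↔-id (Fin (size G))
    ; preserve = λ _ _ → Equivalence.from IntAdj⇔SuccAdj ∘ Equivalence.to Adj⇔SuccAdj
    ; reflect  = λ _ _ → Equivalence.from Adj⇔SuccAdj ∘ Equivalence.to IntAdj⇔SuccAdj
    }
  where open SuccessorEdges s s-injective s²-fixfree

module _ {G : Graph} (triangleFree : TriangleFree (Adj G))
         {p} (H : LinearHypergraph p) (iso : Iso G (numLines H) (IntAdj H)) where

  open Iso iso

  lineOf : Fin (size G) → Fin (numLines H)
  lineOf = Inverse.to bij

  no-three-concurrent : ∀ {a b c x} → a ≢ b → b ≢ c → a ≢ c →
    x ∈ line H (lineOf a) → x ∈ line H (lineOf b) → x ∈ line H (lineOf c) → ⊥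
  no-three-concurrent a≢b b≢c a≢c x∈a x∈b x∈c =
    triangleFree a≢b b≢c a≢c (concurrent⇒Adj a≢b x∈a x∈b) (concurrent⇒Adj b≢c x∈b x∈c)
                             (concurrent⇒Adj a≢c x∈a x∈c)
    where
    concurrent⇒Adj : ∀ {u v x} → u ≢ v → x ∈ line H (lineOf u) → x ∈ line H (lineOf v) →
                     Adj G u v
    concurrent⇒Adj u≢v x∈u x∈v = reflect _ _ (u≢v ∘ Injection.injective (↔⇒↣ bij) , _ , x∈u , x∈v)

  vertices≤points : (s : Fin (size G) → Fin (size G)) → (∀ i → Adj G i (s i)) →
                    (∀ i → s (s i) ≢ i) → size G ≤ p
  vertices≤points s adj s²-fixfree = injective⇒≤ meet-injective
    where
    s-fixfree : ∀ i → s i ≢ i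
    s-fixfree = fixfree²⇒fixfree s²-fixfree

    meet : Fin (size G) → Fin p
    meet i = proj₁ (proj₂ (preserve i (s i) (adj i)))

    meet∈source : ∀ i → meet i ∈ line H (lineOf i)
    meet∈source i = proj₁ (proj₂ (proj₂ (preserve i (s i) (adj i))))

    meet∈target : ∀ i → meet i ∈ line H (lineOf (s i))
    meet∈target i = proj₂ (proj₂ (proj₂ (preserve i (s i) (adj i))))

    meet-injective : Injective _≡_ _≡_ meet
    meet-injective {i} {j} eq with i ≟ j | j ≟ s i
    ... | yes i≡j | _ = i≡j
    ... | no i≢j | yes refl = ⊥-elim (no-three-concurrent
          (s-fixfree i ∘ sym) (s-fixfree (s i) ∘ sym) (s²-fixfree i ∘ sym)
          (meet∈source i) (meet∈target i)
          (subst (_∈ line H (lineOf (s j))) (sym eq) (meet∈target j)))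
    ... | no i≢j | no j≢si = ⊥-elim (no-three-concurrent
          (s-fixfree i ∘ sym) (j≢si ∘ sym) i≢j
          (meet∈source i) (meet∈target i)
          (subst (_∈ line H (lineOf j)) (sym eq) (meet∈source j)))

module _ {n : ℕ} .{{_ : NonZero n}} where

  rotate-adjacent : ∀ i → Adj (cycle n) i (rotate i)
  rotate-adjacent i = inj₁ (toℕ-rotate i)

  cycle-Adj⇔SuccAdj : ∀ {i j} → Adj (cycle n) i j ⇔ SuccAdj rotate i j
  cycle-Adj⇔SuccAdj = mk⇔ (map⊎ toℕ≡⇒≡rotate toℕ≡⇒≡rotate) (map⊎ ≡rotate⇒toℕ≡ ≡rotate⇒toℕ≡)
    where
    toℕ≡⇒≡rotate : ∀ {i j} → toℕ j ≡ (toℕ i + 1) % n → j ≡ rotate i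
    toℕ≡⇒≡rotate {i} eq = toℕ-injective (trans eq (sym (toℕ-rotate i)))
    ≡rotate⇒toℕ≡ : ∀ {i j} → j ≡ rotate i → toℕ j ≡ (toℕ i + 1) % n
    ≡rotate⇒toℕ≡ {i} eq = trans (cong toℕ eq) (toℕ-rotate i)

  cycle-representable : 3 ≤ n → RepresentableWith (cycle n) n
  cycle-representable 3≤n =
    successorGraph-representable rotate-injective (rotate^-fixfree 3≤n) cycle-Adj⇔SuccAdj

  cycle-triangleFree : 4 ≤ n → TriangleFree (Adj (cycle n))
  cycle-triangleFree 4≤n a≢b b≢c a≢c ab bc ac =
    SuccAdj-triangleFree rotate-injective (rotate^-fixfree 4≤n) a≢b b≢c a≢c
      (to cycle-Adj⇔SuccAdj ab) (to cycle-Adj⇔SuccAdj bc) (to cycle-Adj⇔SuccAdj ac)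
    where open Equivalence using (to)

cycle-points≥n : ∀ {n} .{{_ : NonZero n}} {p} → 3 ≤ n → RepresentableWith (cycle n) p → n ≤ p
cycle-points≥n 3≤n (H , iso) with m≤n⇒m<n∨m≡n 3≤n
... | inj₁ 4≤n  =
  vertices≤points (cycle-triangleFree 4≤n) H iso rotate rotate-adjacent (rotate^-fixfree 3≤n)
... | inj₂ refl =
  points≥3 H (proj₁ (Iso.preserve iso Fin.zero (rotate Fin.zero) (rotate-adjacent Fin.zero)))

mainTheorem16 : (n : ℕ) → .{{_ : NonZero n}} → 3 ≤ n → IsV (cycle n) n
mainTheorem16 n 3≤n = cycle-representable 3≤n , λ _ → cycle-points≥n 3≤n
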